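{- Let $n\ge 2$ and let $f$ be a nested canalizing function on $n$ variables, written uniquely as $$f(x_1,\dots,x_n)=M_1(M_2(\cdots(M_{r-1}(M_r\oplus 1)\oplus 1)\cdots)\oplus 1)\oplus b$$ with layer structure $\langle k_1,\dots,k_r\rangle$. Then $$C(f)=\begin{cases}\max\{k_1+k_3+\cdots+k_r,\ k_2+k_4+\cdots+k_{r-1}+1\}, & r\text{ odd},\\ \max\{k_1+k_3+\cdots+k_{r-1}+1,\ k_2+k_4+\cdots+k_r\}, & r\text{ even}.\end{cases}$$ In particular, the certificate complexity of an NCF is uniquely determined by its layer structure.
   Context: $\oplus$ denotes addition modulo 2, $\bar a=a\oplus 1$. A Boolean function $f:\mathbb{F}_2^n\to\mathbb{F}_2$ is nested canalizing (an NCF) if there exist a permutation $\sigma$ of $\{1,\dots,n\}$ and $a_1,\dots,a_n,b_1,\dots,b_n\in\mathbb{F}_2$ such that $f=b_1$ if $x_{\sigma(1)}=a_1$; $f=b_2$ if $x_{\sigma(1)}=\bar a_1, x_{\sigma(2)}=a_2$; $\dots$; $f=b_n$ if $x_{\sigma(i)}=\bar a_i$ for $i<n$ and $x_{\sigma(n)}=a_n$; and $f=\bar b_n$ if $x_{\sigma(i)}=\bar a_i$ for all $i$. It is known that for $n\ge 2$ every NCF can be written uniquely in the form above with $b\in\mathbb{F}_2$, $M_i=\prod_{j=1}^{k_i}(x_{i_j}\oplus a_{i_j})$, $a_{i_j}\in\mathbb{F}_2$, $k_i\ge 1$ for $i<r$, $k_r\ge 2$, $k_1+\cdots+k_r=n$,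 and $\{i_j\}$ running over all of $\{1,\dots,n\}$ exactly once; $M_i$ is the $i$-th layer, $r$ the number of layers and $\langle k_1,\dots,k_r\rangle$ the layer structure. Certificates: a subset $\{i_1,\dots,i_k\}$ is a certificate of $f$ on $\alpha=(a_1,\dots,a_n)$ if fixing $x_{i_1}=a_{i_1},\dots,x_{i_k}=a_{i_k}$ makes $f$ constant; $C(f,\alpha)$ is the minimum size of a certificate on $\alpha$ and $C(f)=\max_{\alpha}C(f,\alpha)$. (For $r$ odd with $r=1$, the sum $k_2+\cdots+k_{r-1}$ is empty.) -}

module Defs where

open import Data.Bool using (Bool; true; false; not; _∧_; _xor_; if_then_else_)
open import Data.Bool.Properties using (_≟_)
open import Data.Nat using (ℕ; zero; suc; _+_; _≤_; _⊔_)
open import Data.Fin using (Fin)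
open import Data.Fin.Subset using (Subset; _∈_; ∣_∣)
open import Data.Fin.Permutation using (Permutation′; _⟨$⟩ʳ_)
open import Data.Vec using (Vec; lookup)
open import Data.List using (List; []; _∷_; map; length; concat; allFin; foldr; tabulate)
open import Data.List.Relation.Binary.Permutation.Propositional using (_↭_)
open import Data.Product using (Σ; _×_; _,_; proj₁)
open import Data.Empty using (⊥)
open import Relation.Nullary using (does)
open import Relation.Binary.PropositionalEquality using (_≡_)

Input : ℕ → Set
Input n = Vec Bool n

BoolFun : ℕ → Set
BoolFun n = Input n → Bool

-- One canalizing step: (variable x_{σ(i)}, canalizing input a_i, canalized output b_i)
-- nestEval [ s_1 , … , s_n ] x : f = b_1 if x_{σ(1)} = a_1, else …, and finally
-- f = ¬ b_n if x_{σ(i)} = ¬ a_i for all i.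
nestEval : ∀ {n} → List (Fin n × Bool × Bool) → Input n → Bool
nestEval [] x = false
nestEval ((i , a , b) ∷ []) x = if does (lookup x i ≟ a) then b else not b
nestEval ((i , a , b) ∷ s ∷ rest) x =
  if does (lookup x i ≟ a) then b else nestEval (s ∷ rest) x

IsNCF : ∀ {n} → BoolFun n → Set
IsNCF {n} f =
  Σ (Permutation′ n) λ σ → Σ (Vec Bool n) λ a → Σ (Vec Bool n) λ b →
    ∀ x → f x ≡ nestEval (tabulate (λ i → (σ ⟨$⟩ʳ i , lookup a i , lookup b i))) x

-- a layer: list of (variable index i_j, a_{i_j}); M = ∏ (x_{i_j} ⊕ a_{i_j})
Layer : ℕ → Set
Layer n = List (Fin n × Bool)

evalLayer : ∀ {n} → Layer n → Input n → Bool
evalLayer [] x = true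
evalLayer ((i , a) ∷ l) x = (lookup x i xor a) ∧ evalLayer l x

evalLayers : ∀ {n} → List (Layer n) → Input n → Bool
evalLayers [] x = false
evalLayers (l ∷ []) x = evalLayer l x
evalLayers (l ∷ m ∷ ls) x = evalLayer l x ∧ (evalLayers (m ∷ ls) x xor true)

layerFormEval : ∀ {n} → List (Layer n) → Bool → Input n → Bool
layerFormEval ls b x = evalLayers ls x xor b

layerStructure : ∀ {n} → List (Layer n) → List ℕ
layerStructure ls = map length ls

ValidStructure : List ℕ → Set
ValidStructure [] = ⊥
ValidStructure (k ∷ []) = 2 ≤ k
ValidStructure (k ∷ k' ∷ ks) = (1 ≤ k) × ValidStructure (k' ∷ ks)

IsLayerForm : ∀ {n} → List (Layer n) → Set
IsLayerForm {n} ls =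
  (map proj₁ (concat ls) ↭ allFin n) × ValidStructure (layerStructure ls)

AgreeOn : ∀ {n} → Subset n → Input n → Input n → Set
AgreeOn S α x = ∀ i → i ∈ S → lookup x i ≡ lookup α i

IsCertificate : ∀ {n} → BoolFun n → Input n → Subset n → Set
IsCertificate f α S = ∀ x y → AgreeOn S α x → AgreeOn S α y → f x ≡ f y

IsCertComplexityAt : ∀ {n} → BoolFun n → Input n → ℕ → Set
IsCertComplexityAt f α m =
  (Σ _ λ S → IsCertificate f α S × ∣ S ∣ ≡ m) ×
  (∀ S → IsCertificate f α S → m ≤ ∣ S ∣)

IsCertComplexity : ∀ {n} → BoolFun n → ℕ → Set
IsCertComplexity f m =
  (∀ α k → IsCertComplexityAt f α k → k ≤ m) ×
  (Σ _ λ α → IsCertComplexityAt f α m)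

oddSum evenSum : List ℕ → ℕ
oddSum [] = 0
oddSum (k ∷ ks) = k + evenSum ks
evenSum [] = 0
evenSum (k ∷ ks) = oddSum ks

isOdd : ℕ → Bool
isOdd zero = false
isOdd (suc n) = not (isOdd n)

certFormula : List ℕ → ℕ
certFormula ks =
  if isOdd (length ks)
  then oddSum ks ⊔ (evenSum ks + 1)
  else (oddSum ks + 1) ⊔ evenSum ks

-- Write g for the nested value M₁ ∧ ¬(M₂ ∧ ¬(⋯ ∧ ¬M_r)); then f = g ⊕ b has exactly the
-- certificates of g. On an input where g takes the value v, a certificate of size
-- cost v ⟨k₁,…,k_r⟩ is read off layer by layer. Conversely every certificate contains
-- every sensitive variable. At the input where no variable takes its canalizing
-- value, and at the input where one variable of M_r is flipped to it, the sensitive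
-- variables number at least the cost of the respective value; the two values differ, so
-- C(f) = cost false ⊔ cost true, whose closed form is the one in the statement.

module Submission where

open import Defs
open import Data.Bool using (Bool; true; false; not; _∧_; _xor_; if_then_else_)
open import Data.Bool.Properties
  using (∧-identityʳ; ∧-zeroʳ; xor-comm; xor-same; xor-inverseˡ; xor-identityʳ;
         not-involutive; not-injective; ¬-not; if-not)
  renaming (_≟_ to _≟ᵇ_)
open import Data.Nat using (ℕ; suc; _+_; _≤_; _⊔_; z≤n; s≤s)
open import Data.Nat.Properties
  using (≤-trans; ≤-refl; ≤-reflexive; ≤-antisym; m≤m⊔n; m≤n⊔m; m≤m+n; ⊔-lub; ⊔-sel; ⊔-comm;
         +-monoʳ-≤; +-identityʳ; +-assoc; m≤n⇒m⊔n≡n)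
open import Data.Fin using (Fin; zero; suc) renaming (_≟_ to _≟ᶠ_)
open import Data.Fin.Subset using (Subset; ∣_∣; ⁅_⁆; _∪_; _-_; ⊥) renaming (_∈_ to _∈ₛ_)
open import Data.Fin.Subset.Properties
  using (_∈?_; x∈⁅x⁆; p⊆p∪q; q⊆p∪q; x∈p∧x≢y⇒x∈p-y; x∈p⇒∣p-x∣<∣p∣; ∣p∣≤∣x∷p∣; ∣⊥∣≡0; ∪-identityˡ)
open import Data.Vec using (lookup; tabulate; updateAt; _∷_)
open import Data.Vec.Properties
  using (lookup∘tabulate; lookup∘updateAt; lookup∘updateAt′; updateAt-updateAt-local; updateAt-id)
open import Data.List using (List; []; _∷_; _++_; _∷ʳ_; map; length; concat; initLast; _∷ʳ′_)
open import Data.List.Properties using (map-++; length-++; length-map; concat-++)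
open import Data.List.Membership.Propositional using (_∈_; _∉_)
open import Data.List.Membership.Propositional.Properties using (∈-map⁺; ∈-++⁺ˡ; ∈-++⁺ʳ; ∈-++⁻)
open import Data.List.Relation.Binary.Subset.Propositional using (_⊆_)
open import Data.List.Relation.Binary.Disjoint.Propositional using (Disjoint)
open import Data.List.Relation.Unary.Any using (here; there)
open import Data.List.Relation.Unary.All as All using (All; []; _∷_)
import Data.List.Relation.Unary.All.Properties as AllP
open import Data.List.Relation.Unary.AllPairs using ([]; _∷_)
open import Data.List.Relation.Unary.Unique.Propositional using (Unique)
import Data.List.Relation.Unary.Unique.Propositional.Properties as UniqueP
open import Data.List.Relation.Binary.Permutation.Propositional using (↭-sym; ↭⇒↭ₛ)
open import Data.List.Relation.Binary.Permutation.Setoid.Properties using (Unique-resp-↭)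
open import Data.Product using (Σ; ∃; _×_; _,_; proj₁; proj₂)
open import Data.Sum using (_⊎_; inj₁; inj₂; [_,_]; [_,_]′)
open import Data.Empty using (⊥-elim)
open import Function using (_∘_; case_of_)
open import Function.Bundles using (_⇔_; mk⇔; Equivalence)
import Function.Properties.Equivalence as ⇔
open import Level using (Level)
open import Relation.Nullary using (does; yes; no)
open import Relation.Binary.PropositionalEquality
  using (_≡_; _≢_; refl; sym; trans; cong; cong₂; subst; setoid; module ≡-Reasoning)

open ≡-Reasoning

private variable
  a : Level
  A : Set a
  n : ℕ

Unique-++⁻ : ∀ (xs : List A) {ys} → Unique (xs ++ ys) → Unique xs × Unique ys × Disjoint xs ys
Unique-++⁻ [] u = [] , u , λ { (() , _) }
Unique-++⁻ (x ∷ xs) (x∉ ∷ u) with Unique-++⁻ xs u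
... | uxs , uys , disjoint = AllP.++⁻ˡ xs x∉ ∷ uxs , uys , λ
  { (here refl , v∈ys) → All.lookup (AllP.++⁻ʳ xs x∉) v∈ys refl
  ; (there v∈xs , v∈ys) → disjoint (v∈xs , v∈ys) }

xor-cancelʳ : ∀ b {u v} → u xor b ≡ v xor b → u ≡ v
xor-cancelʳ false {u} {v} eq = trans (sym (xor-identityʳ u)) (trans eq (xor-identityʳ v))
xor-cancelʳ true {u} {v} eq = not-injective (trans (xor-comm true u) (trans eq (xor-comm v true)))

≢-cover : ∀ {v w : Bool} → v ≢ w → ∀ u → u ≡ v ⊎ u ≡ w
≢-cover {v} {w} v≢w u with u ≟ᵇ v
... | yes u≡v = inj₁ u≡v
... | no u≢v = inj₂ (trans (¬-not u≢v) (sym (¬-not (v≢w ∘ sym))))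

vars : Layer n → List (Fin n)
vars = map proj₁

-- evalLayers with the innermost layer read as M_r ∧ ¬ false, so one clause covers all layers.
value : List (Layer n) → Input n → Bool
value [] x = false
value (l ∷ ls) x = evalLayer l x ∧ not (value ls x)

evalLayers≡value : ∀ (ls : List (Layer n)) x → evalLayers ls x ≡ value ls x
evalLayers≡value [] x = refl
evalLayers≡value (l ∷ []) x = sym (∧-identityʳ (evalLayer l x))
evalLayers≡value (l ∷ m ∷ ls) x =
  cong (evalLayer l x ∧_) (trans (xor-comm _ true) (cong not (evalLayers≡value (m ∷ ls) x)))

NonCanalized : Layer n → Input n → Set
NonCanalized l x = All (λ (i , a) → lookup x i ≡ not a) l

Agree : List (Fin n) → Input n → Input n → Set
Agree P x y = ∀ {i} → i ∈ P → lookup y i ≡ lookup x i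

evalLayer-nonCanalized : ∀ (l : Layer n) {x} → NonCanalized l x → evalLayer l x ≡ true
evalLayer-nonCanalized [] [] = refl
evalLayer-nonCanalized ((i , a) ∷ l) {x} (xᵢ≡¬a ∷ nc) = begin
  (lookup x i xor a) ∧ evalLayer l x
    ≡⟨ cong₂ _∧_ (cong (_xor a) xᵢ≡¬a) (evalLayer-nonCanalized l nc) ⟩
  (not a xor a) ∧ true
    ≡⟨ cong (_∧ true) (xor-inverseˡ a) ⟩
  true ∎

evalLayer-canalized : ∀ (l : Layer n) {x i a} → (i , a) ∈ l → lookup x i ≡ a → evalLayer l x ≡ false
evalLayer-canalized ((i , a) ∷ l) {x} (here refl) xᵢ≡a =
  cong (_∧ evalLayer l x) (trans (cong (_xor a) xᵢ≡a) (xor-same a))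
evalLayer-canalized ((j , b) ∷ l) {x} (there e∈l) xᵢ≡a =
  trans (cong ((lookup x j xor b) ∧_) (evalLayer-canalized l e∈l xᵢ≡a)) (∧-zeroʳ _)

evalLayer-false⇒canalized : ∀ (l : Layer n) x → evalLayer l x ≡ false →
  Σ (Fin n × Bool) λ (i , a) → (i , a) ∈ l × lookup x i ≡ a
evalLayer-false⇒canalized ((i , a) ∷ l) x l≡false with lookup x i ≟ᵇ a
... | yes xᵢ≡a = (i , a) , here refl , xᵢ≡a
... | no xᵢ≢a with evalLayer-false⇒canalized l x rest≡false
  where
  rest≡false : evalLayer l x ≡ false
  rest≡false =
    trans (cong (_∧ evalLayer l x) (sym (trans (cong (_xor a) (¬-not xᵢ≢a)) (xor-inverseˡ a)))) l≡false
...   | e , e∈l , canalized = e , there e∈l , canalized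

length-vars-++ : ∀ (l : Layer n) P → length (vars l ++ P) ≡ length l + length P
length-vars-++ l P = trans (length-++ (vars l)) (cong (_+ length P) (length-map proj₁ l))

evalLayer-cong : ∀ (l : Layer n) {x y} → Agree (vars l) x y → evalLayer l y ≡ evalLayer l x
evalLayer-cong [] _ = refl
evalLayer-cong ((i , a) ∷ l) agree =
  cong₂ _∧_ (cong (_xor a) (agree (here refl))) (evalLayer-cong l (agree ∘ there))

-- A false value is certified by one canalizing variable of the outer layer, or by a
-- true-certificate of the inner layers; a true value needs the whole outer layer
-- together with a false-certificate of the inner layers.
cost : Bool → List ℕ → ℕ
cost false [] = 0
cost false (k ∷ ks) = 1 ⊔ cost true ks
cost true [] = 1   -- never attained (value [] = false); 1 makes the closed form uniform
cost true (k ∷ ks) = k + cost false ks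

CertifiedBy : BoolFun n → Input n → List (Fin n) → Set
CertifiedBy g x P = ∀ y → Agree P x y → g y ≡ g x

certificate-upper : ∀ (ls : List (Layer n)) x →
  ∃ λ P → length P ≤ cost (value ls x) (map length ls) × CertifiedBy (value ls) x P
certificate-upper [] x = [] , z≤n , λ _ _ → refl
certificate-upper (l ∷ ls) x with evalLayer l x in l≡
... | false with evalLayer-false⇒canalized l x l≡
...   | (i , a) , e∈l , canalized =
  i ∷ [] , m≤m⊔n 1 (cost true (map length ls)) ,
  λ y agree → cong (_∧ not (value ls y)) (evalLayer-canalized l e∈l (trans (agree (here refl)) canalized))
certificate-upper (l ∷ ls) x | true with value ls x | certificate-upper ls x
... | true | P , |P|≤ , P-certifies =
  P , ≤-trans |P|≤ (m≤n⊔m 1 (cost true (map length ls))) ,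
  λ y agree → trans (cong (λ v → evalLayer l y ∧ not v) (P-certifies y agree)) (∧-zeroʳ _)
... | false | P , |P|≤ , P-certifies =
  vars l ++ P , |l++P|≤ ,
  λ y agree → cong₂ (λ u v → u ∧ not v)
    (trans (evalLayer-cong l (agree ∘ ∈-++⁺ˡ)) l≡) (P-certifies y (agree ∘ ∈-++⁺ʳ (vars l)))
  where
  |l++P|≤ : length (vars l ++ P) ≤ length l + cost false (map length ls)
  |l++P|≤ = ≤-trans (≤-reflexive (length-vars-++ l P)) (+-monoʳ-≤ (length l) |P|≤)

flipAt : Input n → Fin n → Input n
flipAt x i = updateAt x i not

Sensitive : BoolFun n → Input n → Fin n → Set
Sensitive g x i = g (flipAt x i) ≢ g x

sensitive∈certificate : ∀ {g : BoolFun n} {α S i} → IsCertificate g α S → Sensitive g α i → i ∈ₛ S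
sensitive∈certificate {α = α} {S} {i} certificate sensitive with i ∈? S
... | yes i∈S = i∈S
... | no i∉S = ⊥-elim (sensitive (certificate (flipAt α i) α agree (λ _ _ → refl)))
  where
  agree : AgreeOn S α (flipAt α i)
  agree j j∈S = lookup∘updateAt′ j i (λ { refl → i∉S j∈S }) α

length≤∣∣ : ∀ {Q : List (Fin n)} {S} → Unique Q → All (_∈ₛ S) Q → length Q ≤ ∣ S ∣
length≤∣∣ [] [] = z≤n
length≤∣∣ (i∉Q ∷ uQ) (i∈S ∷ Q⊆S) =
  ≤-trans (s≤s (length≤∣∣ uQ (All.zipWith (λ (i≢j , j∈S) → x∈p∧x≢y⇒x∈p-y j∈S (i≢j ∘ sym)) (i∉Q , Q⊆S))))
          (x∈p⇒∣p-x∣<∣p∣ i∈S)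

toSubset : List (Fin n) → Subset n
toSubset [] = ⊥
toSubset (i ∷ P) = ⁅ i ⁆ ∪ toSubset P

∈-toSubset : ∀ {P : List (Fin n)} {i} → i ∈ P → i ∈ₛ toSubset P
∈-toSubset {P = i ∷ P} (here refl) = p⊆p∪q (toSubset P) (x∈⁅x⁆ i)
∈-toSubset {P = j ∷ P} (there i∈P) = q⊆p∪q ⁅ j ⁆ (toSubset P) (∈-toSubset i∈P)

∣⁅i⁆∪p∣≤1+∣p∣ : ∀ (i : Fin n) p → ∣ ⁅ i ⁆ ∪ p ∣ ≤ suc ∣ p ∣
∣⁅i⁆∪p∣≤1+∣p∣ zero (t ∷ p) rewrite ∪-identityˡ p = s≤s (∣p∣≤∣x∷p∣ t p)
∣⁅i⁆∪p∣≤1+∣p∣ (suc i) (true ∷ p) = s≤s (∣⁅i⁆∪p∣≤1+∣p∣ i p)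
∣⁅i⁆∪p∣≤1+∣p∣ (suc i) (false ∷ p) = ∣⁅i⁆∪p∣≤1+∣p∣ i p

∣toSubset∣≤length : ∀ (P : List (Fin n)) → ∣ toSubset P ∣ ≤ length P
∣toSubset∣≤length {n} [] = ≤-reflexive (∣⊥∣≡0 n)
∣toSubset∣≤length (i ∷ P) = ≤-trans (∣⁅i⁆∪p∣≤1+∣p∣ i (toSubset P)) (s≤s (∣toSubset∣≤length P))

certifiedBy⇒isCertificate : ∀ {g : BoolFun n} {α P} → CertifiedBy g α P → IsCertificate g α (toSubset P)
certifiedBy⇒isCertificate certified x y αx αy =
  trans (certified x (λ i∈P → αx _ (∈-toSubset i∈P))) (sym (certified y (λ i∈P → αy _ (∈-toSubset i∈P))))

certComplexityAt≤ : ∀ {g : BoolFun n} {α P k} → CertifiedBy g α P → IsCertComplexityAt g α k → k ≤ length P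
certComplexityAt≤ {P = P} certified (_ , minimal) =
  ≤-trans (minimal _ (certifiedBy⇒isCertificate certified)) (∣toSubset∣≤length P)

certComplexityAt-squeeze : ∀ {g : BoolFun n} {α P Q m} → CertifiedBy g α P → length P ≤ m →
  Unique Q → All (Sensitive g α) Q → m ≤ length Q → IsCertComplexityAt g α m
certComplexityAt-squeeze {g = g} {α} {P} {m = m} certified P≤m uQ sensitive m≤Q =
  (toSubset P , certificate , ≤-antisym (≤-trans (∣toSubset∣≤length P) P≤m) (minimal _ certificate)) , minimal
  where
  certificate : IsCertificate g α (toSubset P)
  certificate = certifiedBy⇒isCertificate certified
  minimal : ∀ S → IsCertificate g α S → m ≤ ∣ S ∣
  minimal S S-certificate = ≤-trans m≤Q (length≤∣∣ uQ (All.map (sensitive∈certificate S-certificate) sensitive))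

isCertComplexityAt-resp : ∀ {f g : BoolFun n} {α m} → (∀ x y → f x ≡ f y ⇔ g x ≡ g y) →
  IsCertComplexityAt f α m → IsCertComplexityAt g α m
isCertComplexityAt-resp f⇔g ((S , certificate , ∣S∣≡m) , minimal) =
  (S , (λ x y αx αy → Equivalence.to (f⇔g x y) (certificate x y αx αy)) , ∣S∣≡m) ,
  λ T T-certificate → minimal T (λ x y αx αy → Equivalence.from (f⇔g x y) (T-certificate x y αx αy))

isCertComplexity-resp : ∀ {f g : BoolFun n} {m} → (∀ x y → f x ≡ f y ⇔ g x ≡ g y) →
  IsCertComplexity f m → IsCertComplexity g m
isCertComplexity-resp f⇔g (bounded , α , attained) =
  (λ β k → bounded β k ∘ isCertComplexityAt-resp {α = β} (λ x y → ⇔.sym (f⇔g x y))) ,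
  α , isCertComplexityAt-resp {α = α} f⇔g attained

flipAt-involutive : ∀ (x : Input n) i → flipAt (flipAt x i) i ≡ x
flipAt-involutive x i = trans (updateAt-updateAt-local i x (not-involutive (lookup x i))) (updateAt-id i x)

nonCanalized-flipAt : ∀ (l : Layer n) {x i} → i ∉ vars l → NonCanalized l x → NonCanalized l (flipAt x i)
nonCanalized-flipAt l {x} {i} i∉l nc = All.tabulate λ {(j , a)} e∈l →
  trans (lookup∘updateAt′ j i (λ { refl → i∉l (∈-map⁺ proj₁ e∈l) }) x) (All.lookup nc e∈l)

flipAt-canalizes : ∀ (l : Layer n) {x i a} → NonCanalized l x → (i , a) ∈ l → evalLayer l (flipAt x i) ≡ false
flipAt-canalizes l {x} {i} {a} nc e∈l = evalLayer-canalized l e∈l (begin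
  lookup (flipAt x i) i  ≡⟨ lookup∘updateAt i x ⟩
  not (lookup x i)       ≡⟨ cong not (All.lookup nc e∈l) ⟩
  not (not a)            ≡⟨ not-involutive a ⟩
  a                      ∎)

value-∷-nonCanalized : ∀ (l : Layer n) ls {x} → NonCanalized l x → value (l ∷ ls) x ≡ not (value ls x)
value-∷-nonCanalized l ls {x} nc = cong (_∧ not (value ls x)) (evalLayer-nonCanalized l nc)

value-++-≢ : ∀ (us : List (Layer n)) {ms x y} → NonCanalized (concat us) x → NonCanalized (concat us) y →
  value ms x ≢ value ms y → value (us ++ ms) x ≢ value (us ++ ms) y
value-++-≢ [] _ _ ms≢ = ms≢
value-++-≢ (u ∷ us) {ms} {x} {y} ncx ncy ms≢ us++ms≡ =
  value-++-≢ us (AllP.++⁻ʳ u ncx) (AllP.++⁻ʳ u ncy) ms≢ (not-injective (begin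
    not (value (us ++ ms) x)  ≡⟨ value-∷-nonCanalized u (us ++ ms) (AllP.++⁻ˡ u ncx) ⟨
    value (u ∷ us ++ ms) x    ≡⟨ us++ms≡ ⟩
    value (u ∷ us ++ ms) y    ≡⟨ value-∷-nonCanalized u (us ++ ms) (AllP.++⁻ˡ u ncy) ⟩
    not (value (us ++ ms) y)  ∎))

sensitive-∷-outside : ∀ (l : Layer n) ls {x i} → NonCanalized l x → i ∉ vars l →
  Sensitive (value ls) x i → Sensitive (value (l ∷ ls)) x i
sensitive-∷-outside l ls {x} {i} nc i∉l sensitive l∷ls≡ = sensitive (not-injective (begin
  not (value ls (flipAt x i))  ≡⟨ value-∷-nonCanalized l ls (nonCanalized-flipAt l {x} i∉l nc) ⟨
  value (l ∷ ls) (flipAt x i)  ≡⟨ l∷ls≡ ⟩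
  value (l ∷ ls) x             ≡⟨ value-∷-nonCanalized l ls nc ⟩
  not (value ls x)             ∎))

sensitive-∷-inside : ∀ (l : Layer n) ls {x i a} → NonCanalized l x → (i , a) ∈ l →
  value ls x ≡ false → Sensitive (value (l ∷ ls)) x i
sensitive-∷-inside l ls {x} {i} nc e∈l ls≡false l∷ls≡ with () ← begin
  false                        ≡⟨ cong (_∧ not (value ls (flipAt x i))) (flipAt-canalizes l nc e∈l) ⟨
  value (l ∷ ls) (flipAt x i)  ≡⟨ l∷ls≡ ⟩
  value (l ∷ ls) x             ≡⟨ value-∷-nonCanalized l ls nc ⟩
  not (value ls x)             ≡⟨ cong not ls≡false ⟩
  true                         ∎

record SensitiveWitness (ls : List (Layer n)) (x : Input n) (m : ℕ) : Set where
  field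
    variables : List (Fin n)
    unique : Unique variables
    sensitive : All (Sensitive (value ls) x) variables
    large : m ≤ length variables
    ⊆vars : variables ⊆ vars (concat ls)

open SensitiveWitness

sensitiveWitness-≤ : ∀ {ls : List (Layer n)} {x m m′} → m′ ≤ m →
  SensitiveWitness ls x m → SensitiveWitness ls x m′
sensitiveWitness-≤ m′≤m w = record
  { variables = variables w ; unique = unique w ; sensitive = sensitive w
  ; large = ≤-trans m′≤m (large w) ; ⊆vars = ⊆vars w }

sensitiveWitness-[] : ∀ {x : Input n} → SensitiveWitness [] x 0
sensitiveWitness-[] = record { variables = [] ; unique = [] ; sensitive = [] ; large = z≤n ; ⊆vars = λ () }

uniqueVars-∷⁻ : ∀ (l : Layer n) ls → Unique (vars (concat (l ∷ ls))) →
  Unique (vars l) × Unique (vars (concat ls)) × Disjoint (vars l) (vars (concat ls))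
uniqueVars-∷⁻ l ls = Unique-++⁻ (vars l) ∘ subst Unique (map-++ proj₁ l (concat ls))

uniqueVars-++⁻ : ∀ (us ms : List (Layer n)) → Unique (vars (concat (us ++ ms))) →
  Unique (vars (concat us)) × Unique (vars (concat ms)) × Disjoint (vars (concat us)) (vars (concat ms))
uniqueVars-++⁻ us ms =
  Unique-++⁻ (vars (concat us)) ∘
    subst Unique (trans (cong vars (sym (concat-++ us ms))) (map-++ proj₁ (concat us) (concat ms)))

1≤cost-true : ∀ {ks} → All (1 ≤_) ks → 1 ≤ cost true ks
1≤cost-true [] = s≤s z≤n
1≤cost-true {k ∷ ks} (1≤k ∷ _) = ≤-trans 1≤k (m≤m+n k _)

module _ (l : Layer n) (ls : List (Layer n)) {x : Input n} (nc : NonCanalized l x)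
         (unique-l : Unique (vars l)) (disjoint : Disjoint (vars l) (vars (concat ls))) where

  private
    vars-l⊆ : vars l ⊆ vars (concat (l ∷ ls))
    vars-l⊆ i∈l = subst (_ ∈_) (sym (map-++ proj₁ l (concat ls))) (∈-++⁺ˡ i∈l)

    vars-ls⊆ : vars (concat ls) ⊆ vars (concat (l ∷ ls))
    vars-ls⊆ i∈ls = subst (_ ∈_) (sym (map-++ proj₁ l (concat ls))) (∈-++⁺ʳ (vars l) i∈ls)

    lift : ∀ {m} (w : SensitiveWitness ls x m) → All (Sensitive (value (l ∷ ls)) x) (variables w)
    lift w = All.tabulate λ i∈w →
      sensitive-∷-outside l ls nc (λ i∈l → disjoint (i∈l , ⊆vars w i∈w)) (All.lookup (sensitive w) i∈w)

  sensitiveWitness-∷-true : ∀ {m} → 1 ≤ m → SensitiveWitness ls x m → SensitiveWitness (l ∷ ls) x (1 ⊔ m)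
  sensitiveWitness-∷-true 1≤m w = record
    { variables = variables w ; unique = unique w ; sensitive = lift w
    ; large = ⊔-lub (≤-trans 1≤m (large w)) (large w) ; ⊆vars = vars-ls⊆ ∘ ⊆vars w }

  sensitiveWitness-∷-false : ∀ {m} → value ls x ≡ false → SensitiveWitness ls x m →
    SensitiveWitness (l ∷ ls) x (length l + m)
  sensitiveWitness-∷-false ls≡false w = record
    { variables = vars l ++ variables w
    ; unique = UniqueP.++⁺ unique-l (unique w) (λ (i∈l , i∈w) → disjoint (i∈l , ⊆vars w i∈w))
    ; sensitive = AllP.++⁺ (AllP.map⁺ (All.tabulate λ e∈l → sensitive-∷-inside l ls nc e∈l ls≡false)) (lift w)
    ; large = ≤-trans (+-monoʳ-≤ (length l) (large w)) (≤-reflexive (sym (length-vars-++ l (variables w))))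
    ; ⊆vars = [ vars-l⊆ , vars-ls⊆ ∘ ⊆vars w ] ∘ ∈-++⁻ (vars l) }

sensitiveWitness-∷ : ∀ (l : Layer n) ls {x} → NonCanalized l x → Unique (vars (concat (l ∷ ls))) →
  1 ≤ cost true (map length ls) →
  SensitiveWitness ls x (cost (value ls x) (map length ls)) →
  SensitiveWitness (l ∷ ls) x (cost (value (l ∷ ls) x) (map length (l ∷ ls)))
sensitiveWitness-∷ l ls {x} nc unique-l∷ls 1≤cost w
  with unique-l , _ , disjoint ← uniqueVars-∷⁻ l ls unique-l∷ls
  with evalLayer l x | evalLayer-nonCanalized l {x} nc | value ls x in ls≡
... | .true | refl | true = sensitiveWitness-∷-true l ls nc unique-l disjoint 1≤cost w
... | .true | refl | false = sensitiveWitness-∷-false l ls nc unique-l disjoint ls≡ w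

sensitiveWitness-++ : ∀ (us ms : List (Layer n)) {x} → NonCanalized (concat us) x →
  Unique (vars (concat (us ++ ms))) → All (1 ≤_) (map length (us ++ ms)) →
  SensitiveWitness ms x (cost (value ms x) (map length ms)) →
  SensitiveWitness (us ++ ms) x (cost (value (us ++ ms) x) (map length (us ++ ms)))
sensitiveWitness-++ [] ms _ _ _ w = w
sensitiveWitness-++ (u ∷ us) ms nc vars-unique (_ ∷ positive) w =
  sensitiveWitness-∷ u (us ++ ms) (AllP.++⁻ˡ u nc) vars-unique (1≤cost-true positive)
    (sensitiveWitness-++ us ms (AllP.++⁻ʳ u nc) (proj₁ (proj₂ (uniqueVars-∷⁻ u (us ++ ms) vars-unique)))
      positive w)

sensitiveWitness-flipped : ∀ (l : Layer n) {x i a} → NonCanalized l x → (i , a) ∈ l →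
  SensitiveWitness (l ∷ []) (flipAt x i) (cost (value (l ∷ []) (flipAt x i)) (length l ∷ []))
sensitiveWitness-flipped l {x} {i} nc e∈l
  with evalLayer l (flipAt x i) | flipAt-canalizes l {x} nc e∈l
... | .false | refl = record
  { variables = i ∷ [] ; unique = [] ∷ [] ; sensitive = i-sensitive ∷ [] ; large = ≤-refl
  ; ⊆vars = λ { (here refl) → ∈-map⁺ proj₁ (∈-++⁺ˡ e∈l) } }
  where
  i-sensitive : Sensitive (value (l ∷ [])) (flipAt x i) i
  i-sensitive flipped≡ with () ← begin
    true                                         ≡⟨ evalLayer-nonCanalized l nc ⟨
    evalLayer l x                                ≡⟨ cong (evalLayer l) (flipAt-involutive x i) ⟨
    evalLayer l (flipAt (flipAt x i) i)          ≡⟨ ∧-identityʳ _ ⟨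
    value (l ∷ []) (flipAt (flipAt x i) i)       ≡⟨ flipped≡ ⟩
    value (l ∷ []) (flipAt x i)                  ≡⟨ cong (_∧ true) (flipAt-canalizes l nc e∈l) ⟩
    false                                        ∎

avoiding : List (Fin n × Bool) → Fin n → Bool
avoiding [] i = false
avoiding ((j , a) ∷ L) i = if does (i ≟ᶠ j) then not a else avoiding L i

avoiding-∈ : ∀ (L : Layer n) → Unique (vars L) → ∀ {i a} → (i , a) ∈ L → avoiding L i ≡ not a
avoiding-∈ ((j , a) ∷ L) _ {i} (here refl) with i ≟ᶠ i
... | yes _ = refl
... | no i≢i = ⊥-elim (i≢i refl)
avoiding-∈ ((j , b) ∷ L) (j∉L ∷ unique) {i} (there e∈L) with i ≟ᶠ j
... | yes refl = ⊥-elim (All.lookup j∉L (∈-map⁺ proj₁ e∈L) refl)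
... | no _ = avoiding-∈ L unique e∈L

nonCanalizingInput : Layer n → Input n
nonCanalizingInput L = tabulate (avoiding L)

nonCanalized-nonCanalizingInput : ∀ (L : Layer n) → Unique (vars L) → NonCanalized L (nonCanalizingInput L)
nonCanalized-nonCanalizingInput L unique = All.tabulate λ {(i , a)} e∈L →
  trans (lookup∘tabulate (avoiding L) i) (avoiding-∈ L unique e∈L)

nonCanalized-++⁻ : ∀ (us ms : List (Layer n)) {x} → NonCanalized (concat (us ++ ms)) x →
  NonCanalized (concat us) x × NonCanalized (concat ms) x
nonCanalized-++⁻ us ms {x} = AllP.++⁻ (concat us) ∘ subst (λ L → NonCanalized L x) (sym (concat-++ us ms))

max-attained : ∀ (f : Bool → ℕ) → ∃ λ u → f false ⊔ f true ≡ f u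
max-attained f = [ (false ,_) , (true ,_) ]′ (⊔-sel (f false) (f true))

sensitiveWitness-⊔ : ∀ (ls : List (Layer n)) {α β} → value ls α ≢ value ls β →
  SensitiveWitness ls α (cost (value ls α) (map length ls)) →
  SensitiveWitness ls β (cost (value ls β) (map length ls)) →
  ∃ λ γ → SensitiveWitness ls γ (cost false (map length ls) ⊔ cost true (map length ls))
sensitiveWitness-⊔ ls {α} {β} α≢β wα wβ with u , max≡ ← max-attained (λ v → cost v (map length ls))
  with ≢-cover α≢β u
... | inj₁ refl = α , sensitiveWitness-≤ (≤-reflexive max≡) wα
... | inj₂ refl = β , sensitiveWitness-≤ (≤-reflexive max≡) wβ

module _ (us : List (Layer n)) (l : Layer n) {i a} (e∈l : (i , a) ∈ l)
         (vars-unique : Unique (vars (concat (us ∷ʳ l))))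
         (positive : All (1 ≤_) (map length (us ∷ʳ l))) where

  private
    x : Input n
    x = nonCanalizingInput (concat (us ∷ʳ l))

    nc : NonCanalized (concat us) x × NonCanalized (concat (l ∷ [])) x
    nc = nonCanalized-++⁻ us (l ∷ []) {x} (nonCanalized-nonCanalizingInput (concat (us ∷ʳ l)) vars-unique)

    nc-l : NonCanalized l x
    nc-l = AllP.++⁻ˡ l (proj₂ nc)

    unique-split : Unique (vars (concat us)) × Unique (vars (concat (l ∷ [])))
                   × Disjoint (vars (concat us)) (vars (concat (l ∷ [])))
    unique-split = uniqueVars-++⁻ us (l ∷ []) vars-unique

    nc-flipped : NonCanalized (concat us) (flipAt x i)
    nc-flipped = nonCanalized-flipAt (concat us) {x}
      (λ i∈us → proj₂ (proj₂ unique-split) (i∈us , ∈-map⁺ proj₁ (∈-++⁺ˡ e∈l))) (proj₁ nc)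

    values≢ : value (us ∷ʳ l) x ≢ value (us ∷ʳ l) (flipAt x i)
    values≢ = value-++-≢ us (proj₁ nc) nc-flipped λ l≡ → case (begin
      true                         ≡⟨ cong (_∧ true) (evalLayer-nonCanalized l nc-l) ⟨
      value (l ∷ []) x             ≡⟨ l≡ ⟩
      value (l ∷ []) (flipAt x i)  ≡⟨ cong (_∧ true) (flipAt-canalizes l {x} nc-l e∈l) ⟩
      false                        ∎) of λ ()

  sensitiveWitness-snoc : ∃ λ α → SensitiveWitness (us ∷ʳ l) α
    (cost false (map length (us ∷ʳ l)) ⊔ cost true (map length (us ∷ʳ l)))
  sensitiveWitness-snoc = sensitiveWitness-⊔ (us ∷ʳ l) values≢
    (sensitiveWitness-++ us (l ∷ []) (proj₁ nc) vars-unique positive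
      (sensitiveWitness-∷ l [] nc-l (proj₁ (proj₂ unique-split)) (s≤s z≤n) sensitiveWitness-[]))
    (sensitiveWitness-++ us (l ∷ []) nc-flipped vars-unique positive (sensitiveWitness-flipped l {x} nc-l e∈l))

validStructure⇒positive : ∀ {ks} → ValidStructure ks → All (1 ≤_) ks
validStructure⇒positive {k ∷ []} 2≤k = ≤-trans (s≤s z≤n) 2≤k ∷ []
validStructure⇒positive {k ∷ _ ∷ _} (1≤k , valid) = 1≤k ∷ validStructure⇒positive valid

sensitiveWitness-max : ∀ (ls : List (Layer n)) → Unique (vars (concat ls)) → ValidStructure (map length ls) →
  ∃ λ α → SensitiveWitness ls α (cost false (map length ls) ⊔ cost true (map length ls))
sensitiveWitness-max ls vars-unique valid with initLast ls
sensitiveWitness-max .[] _ () | []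
... | us ∷ʳ′ [] with () ← All.lookup (validStructure⇒positive valid)
                                     (∈-map⁺ length (∈-++⁺ʳ us (here refl)))
... | us ∷ʳ′ (e ∷ l) = sensitiveWitness-snoc us (e ∷ l) (here refl) vars-unique (validStructure⇒positive valid)

cost≤cost⊔cost : ∀ v ks → cost v ks ≤ cost false ks ⊔ cost true ks
cost≤cost⊔cost false ks = m≤m⊔n (cost false ks) (cost true ks)
cost≤cost⊔cost true ks = m≤n⊔m (cost false ks) (cost true ks)

certComplexity-value : ∀ (ls : List (Layer n)) → Unique (vars (concat ls)) → ValidStructure (map length ls) →
  IsCertComplexity (value ls) (cost false (map length ls) ⊔ cost true (map length ls))
certComplexity-value ls vars-unique valid = bounded , attained (sensitiveWitness-max ls vars-unique valid)
  where
  ks : List ℕ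
  ks = map length ls

  bounded : ∀ α k → IsCertComplexityAt (value ls) α k → k ≤ cost false ks ⊔ cost true ks
  bounded α k C-at-α with P , |P|≤ , certified ← certificate-upper ls α =
    ≤-trans (certComplexityAt≤ certified C-at-α) (≤-trans |P|≤ (cost≤cost⊔cost (value ls α) ks))

  attained : (∃ λ α → SensitiveWitness ls α (cost false ks ⊔ cost true ks)) →
    ∃ λ α → IsCertComplexityAt (value ls) α (cost false ks ⊔ cost true ks)
  attained (α , w) with P , |P|≤ , certified ← certificate-upper ls α =
    α , certComplexityAt-squeeze certified (≤-trans |P|≤ (cost≤cost⊔cost (value ls α) ks))
                                 (unique w) (sensitive w) (large w)

cost-closedForm : ∀ {ks} → All (1 ≤_) ks →
  cost false ks ≡ evenSum ks + (if isOdd (length ks) then 1 else 0) ×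
  cost true ks ≡ oddSum ks + (if isOdd (length ks) then 0 else 1)
cost-closedForm [] = refl , refl
cost-closedForm {k ∷ ks} (_ ∷ positive) with false≡ , true≡ ← cost-closedForm positive =
  (begin
    1 ⊔ cost true ks                             ≡⟨ m≤n⇒m⊔n≡n (1≤cost-true positive) ⟩
    cost true ks                                 ≡⟨ true≡ ⟩
    oddSum ks + (if odd then 0 else 1)           ≡⟨ cong (oddSum ks +_) (if-not odd) ⟨
    oddSum ks + (if not odd then 1 else 0)       ∎) ,
  (begin
    k + cost false ks                            ≡⟨ cong (k +_) false≡ ⟩
    k + (evenSum ks + (if odd then 1 else 0))    ≡⟨ +-assoc k (evenSum ks) _ ⟨
    k + evenSum ks + (if odd then 1 else 0)      ≡⟨ cong (k + evenSum ks +_) (if-not odd) ⟨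
    k + evenSum ks + (if not odd then 0 else 1)  ∎)
  where
  odd : Bool
  odd = isOdd (length ks)

certFormula≡cost : ∀ ks → All (1 ≤_) ks → certFormula ks ≡ cost false ks ⊔ cost true ks
certFormula≡cost ks positive with false≡ , true≡ ← cost-closedForm positive
  rewrite false≡ | true≡ with isOdd (length ks)
... | true = trans (⊔-comm (oddSum ks) _) (cong (evenSum ks + 1 ⊔_) (sym (+-identityʳ (oddSum ks))))
... | false = trans (⊔-comm (oddSum ks + 1) _) (cong (_⊔ (oddSum ks + 1)) (sym (+-identityʳ (evenSum ks))))

sameKernel-xor : ∀ {f g : BoolFun n} b → (∀ x → f x ≡ g x xor b) → ∀ x y → g x ≡ g y ⇔ f x ≡ f y
sameKernel-xor b f≡ x y = mk⇔
  (λ gx≡gy → trans (f≡ x) (trans (cong (_xor b) gx≡gy) (sym (f≡ y))))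
  (λ fx≡fy → xor-cancelʳ b (trans (sym (f≡ x)) (trans fx≡fy (f≡ y))))

corollary3p8 : (n : ℕ) → 2 ≤ n → (f : BoolFun n) → IsNCF f →
    (ls : List (Layer n)) (b : Bool) → IsLayerForm ls →
    (∀ x → f x ≡ layerFormEval ls b x) →
    IsCertComplexity f (certFormula (layerStructure ls))
corollary3p8 n _ f _ ls b (vars↭allFin , valid) f≡ =
  isCertComplexity-resp (sameKernel-xor b (λ x → trans (f≡ x) (cong (_xor b) (evalLayers≡value ls x))))
    (subst (IsCertComplexity (value ls)) (sym (certFormula≡cost ks (validStructure⇒positive valid)))
      (certComplexity-value ls vars-unique valid))
  where
  ks : List ℕ
  ks = map length ls

  vars-unique : Unique (vars (concat ls))
  vars-unique = Unique-resp-↭ (setoid (Fin n)) (↭⇒↭ₛ (↭-sym vars↭allFin)) (UniqueP.allFin⁺ n)
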